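{- For every integer $n\ge 3$, $D_{\min}(K_{1,n})=D'_{\min}(K_{1,n})=\lceil n/2\rceil$, $D_{\max}(K_{1,n})=D'_{\max}(K_{1,n})=n$, $\chi_{D,\min}(K_{1,n})=1+\lceil n/2\rceil$, $\chi_{D,\max}(K_{1,n})=n+1$, and $\chi'_{D,\min}(K_{1,n})=\chi'_{D,\max}(K_{1,n})=n$, where $K_{1,n}$ is the star with $n$ leaves.
   Context: An orientation of a simple graph assigns one direction to each edge. An automorphism of an oriented graph is a permutation $\phi$ of its vertices such that $\phi(u)\phi(v)$ is an arc whenever $uv$ is an arc. An $r$-vertex-labelling maps vertices to $\{1,\dots,r\}$, an $r$-arc-labelling maps arcs to $\{1,\dots,r\}$; colourings are proper labellings (adjacent vertices, resp. arcs sharing an end-vertex, get distinct labels). A labelling $\lambda$ is distinguishing if the only automorphism $\phi$ with $\lambda(\phi(u))=\lambda(u)$ for all vertices (resp. $\lambda(\phi(u)\phi(v))=\lambda(uv)$ for all arcs) is the identity. For an oriented graph $\vec G$, $D(\vec G)$, $\chi_D(\vec G)$, $D'(\vec G)$, $\chi'_D(\vec G)$ are the least $r$ for which $\vec G$ admits a distinguishing $r$-vertex-labelling, $r$-vertex-colouring, $r$-arc-labelling, $r$-arc-colouring. For an undirected graph $G$, $D_{\min}(G)$ and $D_{\max}(G)$ are the minimum and maximum of $D(\vec G)$ over all orientations $\vec G$ of $G$; analogously $\chi_{D,\min},\chi_{D,\max}$ for $\chi_D$, $D'_{\min},D'_{\max}$ for $D'$, and $\chi'_{D,\min},\chi'_{D,\max}$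 for $\chi'_D$. -}

module Defs where

open import Data.Nat using (ℕ; suc; _≤_)
open import Data.Fin using (Fin; zero; suc)
open import Data.Fin.Permutation using (Permutation′; _⟨$⟩ʳ_)
open import Data.Bool using (Bool; true; false)
open import Data.Product using (Σ; _×_; ∃-syntax)
open import Data.Sum using (_⊎_)
open import Relation.Binary.PropositionalEquality using (_≡_; _≢_)
open import Relation.Nullary using (¬_)

record Graph (m : ℕ) : Set where
  field
    adj   : Fin m → Fin m → Bool
    sym   : ∀ u v → adj u v ≡ true → adj v u ≡ true
    irref : ∀ u → adj u u ≡ false
open Graph public

-- The star K_{1,n}: vertex 0 is the centre, vertices suc i (i : Fin n) are the leaves.
starAdj : ∀ {n} → Fin (suc n) → Fin (suc n) → Bool
starAdj zero    zero    = false
starAdj zero    (suc _) = true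
starAdj (suc _) zero    = true
starAdj (suc _) (suc _) = false

starSym : ∀ {n} (u v : Fin (suc n)) → starAdj u v ≡ true → starAdj v u ≡ true
starSym zero    (suc _) p = p
starSym (suc _) zero    p = p

starIrref : ∀ {n} (u : Fin (suc n)) → starAdj u u ≡ false
starIrref zero    = _≡_.refl
starIrref (suc _) = _≡_.refl

K1 : (n : ℕ) → Graph (suc n)
K1 n = record { adj = starAdj ; sym = starSym ; irref = starIrref }

record Orientation {m : ℕ} (G : Graph m) : Set where
  field
    arc      : Fin m → Fin m → Bool
    arc-edge : ∀ u v → arc u v ≡ true → adj G u v ≡ true
    total    : ∀ u v → adj G u v ≡ true → arc u v ≡ true ⊎ arc v u ≡ true
    antisym  : ∀ u v → arc u v ≡ true → ¬ (arc v u ≡ true)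
open Orientation public

module _ {m : ℕ} {G : Graph m} (O : Orientation G) where

  IsAut : Permutation′ m → Set
  IsAut φ = ∀ u v → arc O u v ≡ true → arc O (φ ⟨$⟩ʳ u) (φ ⟨$⟩ʳ v) ≡ true

  IsIdentity : Permutation′ m → Set
  IsIdentity φ = ∀ u → φ ⟨$⟩ʳ u ≡ u

  -- labels {1,…,r} are represented by Fin r
  DistinguishingV : (r : ℕ) → (Fin m → Fin r) → Set
  DistinguishingV r λv = ∀ φ → IsAut φ → (∀ u → λv (φ ⟨$⟩ʳ u) ≡ λv u) → IsIdentity φ

  -- an arc-labelling is a function on ordered pairs; only its values on arcs matter
  DistinguishingA : (r : ℕ) → (Fin m → Fin m → Fin r) → Set
  DistinguishingA r λa = ∀ φ → IsAut φ →
    (∀ u v → arc O u v ≡ true → λa (φ ⟨$⟩ʳ u) (φ ⟨$⟩ʳ v) ≡ λa u v) → IsIdentity φ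

  ProperV : (r : ℕ) → (Fin m → Fin r) → Set
  ProperV r λv = ∀ u v → arc O u v ≡ true → λv u ≢ λv v

  ProperA : (r : ℕ) → (Fin m → Fin m → Fin r) → Set
  ProperA r λa = ∀ u v u' v' → arc O u v ≡ true → arc O u' v' ≡ true →
    ¬ (u ≡ u' × v ≡ v') →
    (u ≡ u' ⊎ u ≡ v' ⊎ v ≡ u' ⊎ v ≡ v') →
    λa u v ≢ λa u' v'

  HasDistVLabelling HasDistVColouring HasDistALabelling HasDistAColouring : ℕ → Set
  HasDistVLabelling r = Σ (Fin m → Fin r) (DistinguishingV r)
  HasDistVColouring r = Σ (Fin m → Fin r) (λ λv → ProperV r λv × DistinguishingV r λv)
  HasDistALabelling r = Σ (Fin m → Fin m → Fin r) (DistinguishingA r)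
  HasDistAColouring r = Σ (Fin m → Fin m → Fin r) (λ λa → ProperA r λa × DistinguishingA r λa)

IsLeast : (ℕ → Set) → ℕ → Set
IsLeast P k = P k × (∀ r → P r → k ≤ r)

D≡ χD≡ D'≡ χ'D≡ : ∀ {m} {G : Graph m} → Orientation G → ℕ → Set
D≡   O = IsLeast (HasDistVLabelling O)
χD≡  O = IsLeast (HasDistVColouring O)
D'≡  O = IsLeast (HasDistALabelling O)
χ'D≡ O = IsLeast (HasDistAColouring O)

MinOver MaxOver : ∀ {m} (G : Graph m) → (Orientation G → ℕ → Set) → ℕ → Set
MinOver G inv k = (∃[ O ] inv O k) × (∀ O k' → inv O k' → k ≤ k')
MaxOver G inv k = (∃[ O ] inv O k) × (∀ O k' → inv O k' → k' ≤ k)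

-- Once the star has two leaves, an automorphism of an oriented star must fix
-- the centre and send every leaf to a leaf whose arc points the same way, and
-- conversely every such permutation is an automorphism.  Since transpositions
-- are among these, a labelling (of vertices, or of arcs read off at their
-- leaves) is distinguishing exactly when leaves of the same direction get
-- distinct labels.  Counting in Bool × Fin r gives n ≤ 2r, i.e. ⌈n/2⌉ ≤ r,
-- attained by orienting half of the leaves outwards; orienting all leaves
-- outwards forces n ≤ r.  Proper colourings cost one extra colour for the
-- centre, and a proper arc colouring must be injective since all arcs meet at
-- the centre.
module Submission where

open import Defs
open import Data.Nat using (ℕ; suc; _≤_; _+_; ⌈_/2⌉)
open import Data.Product using (_×_)

open import Data.Nat using (zero; z≤n; s≤s)
import Data.Nat.Properties as ℕ
open import Data.Fin using (Fin; zero; suc; splitAt; join; inject≤; punchOut)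
open import Data.Fin.Properties
  using (_≟_; suc-injective; injective⇒≤; splitAt-join; join-splitAt; inject≤-injective; punchOut-injective)
open import Data.Fin.Permutation using (Permutation′; _⟨$⟩ʳ_; transpose)
open import Data.Vec.Functional using (_∷_)
open import Data.Bool using (Bool; true; false; not; if_then_else_)
open import Data.Bool.Properties using (if-eta)
open import Data.Maybe using (Maybe; just; nothing)
open import Data.Maybe.Properties using (just-injective)
open import Data.Sum using (_⊎_; inj₁; inj₂)
open import Data.Product using (Σ; ∃-syntax; _,_; proj₁; proj₂; map₁)
open import Function using (_∘_; const; id; Injective; _⇔_; mk⇔; Equivalence; Injection)
import Function.Properties.Equivalence as ⇔
open import Function.Properties.Inverse using (↔⇒↣)
open import Relation.Nullary using (yes; no; contradiction)
open import Relation.Binary.PropositionalEquality as ≡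
  using (_≡_; _≢_; refl; trans; cong; cong₂; subst; module ≡-Reasoning)

open Equivalence using (to; from)

permutation-injective : ∀ {m} (φ : Permutation′ m) → Injective _≡_ _≡_ (φ ⟨$⟩ʳ_)
permutation-injective φ = Injection.injective (↔⇒↣ φ)

module _ {m : ℕ} {A : Set} where

  Preserves : (Fin m → A) → Permutation′ m → Set
  Preserves f φ = ∀ u → f (φ ⟨$⟩ʳ u) ≡ f u

  Rigid : (Fin m → A) → Set
  Rigid f = ∀ φ → Preserves f φ → ∀ u → φ ⟨$⟩ʳ u ≡ u

  transpose-preserves : ∀ {f : Fin m → A} {i j} → f i ≡ f j → Preserves f (transpose i j)
  transpose-preserves {i = i} {j} fi≡fj k with k ≟ i
  ... | yes refl = ≡.sym fi≡fj
  ... | no _ with k ≟ j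
  ...   | yes refl = fi≡fj
  ...   | no _     = refl

  transpose-moves : ∀ (i j : Fin m) → transpose i j ⟨$⟩ʳ i ≡ j
  transpose-moves i j with i ≟ i
  ... | yes _  = refl
  ... | no i≢i = contradiction refl i≢i

  rigid⇔injective : ∀ {f : Fin m → A} → Rigid f ⇔ Injective _≡_ _≡_ f
  rigid⇔injective {f} = mk⇔ rigid⇒injective (λ inj φ pres u → inj (pres u))
    where
    rigid⇒injective : Rigid f → Injective _≡_ _≡_ f
    rigid⇒injective rigid {i} {j} fi≡fj with i ≟ j
    ... | yes i≡j = i≡j
    ... | no i≢j  = contradiction
      (trans (≡.sym (rigid (transpose i j) (transpose-preserves fi≡fj) i)) (transpose-moves i j))
      i≢j

module _ {A : Set} where

  tag : Bool × A → A ⊎ A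
  tag (true  , x) = inj₁ x
  tag (false , x) = inj₂ x

  untag : A ⊎ A → Bool × A
  untag (inj₁ x) = true  , x
  untag (inj₂ x) = false , x

  untag-tag : ∀ p → untag (tag p) ≡ p
  untag-tag (true  , _) = refl
  untag-tag (false , _) = refl

  tag-untag : ∀ s → tag (untag s) ≡ s
  tag-untag (inj₁ _) = refl
  tag-untag (inj₂ _) = refl

module _ {r : ℕ} where

  toFin : Bool × Fin r → Fin (r + r)
  toFin = join r r ∘ tag

  fromFin : Fin (r + r) → Bool × Fin r
  fromFin = untag ∘ splitAt r

  fromFin-toFin : ∀ p → fromFin (toFin p) ≡ p
  fromFin-toFin p = trans (cong untag (splitAt-join r r (tag p))) (untag-tag p)

  toFin-fromFin : ∀ i → toFin (fromFin i) ≡ i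
  toFin-fromFin i = trans (cong (join r r) (tag-untag (splitAt r i))) (join-splitAt r r i)

module _ {n r : ℕ} where

  injective⇒≤-double : ∀ {f : Fin n → Bool × Fin r} → Injective _≡_ _≡_ f → n ≤ r + r
  injective⇒≤-double inj = injective⇒≤ λ {i} {j} e →
    inj (trans (≡.sym (fromFin-toFin {r} _)) (trans (cong fromFin e) (fromFin-toFin {r} _)))

  ≤-double⇒injection : n ≤ r + r → Σ (Fin n → Bool × Fin r) (Injective _≡_ _≡_)
  ≤-double⇒injection n≤r+r = (λ i → fromFin (inject≤ i n≤r+r)) , λ {i} {j} e →
    inject≤-injective _ _ i j (trans (≡.sym (toFin-fromFin {r} _)) (trans (cong toFin e) (toFin-fromFin {r} _)))

  injective⇒⌈/2⌉≤ : ∀ {f : Fin n → Bool × Fin r} → Injective _≡_ _≡_ f → ⌈ n /2⌉ ≤ r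
  injective⇒⌈/2⌉≤ inj = subst (⌈ n /2⌉ ≤_) (≡.sym (ℕ.n≡⌈n+n/2⌉ r)) (ℕ.⌈n/2⌉-mono (injective⇒≤-double inj))

n≤⌈n/2⌉+⌈n/2⌉ : ∀ n → n ≤ ⌈ n /2⌉ + ⌈ n /2⌉
n≤⌈n/2⌉+⌈n/2⌉ n = subst (_≤ ⌈ n /2⌉ + ⌈ n /2⌉) (ℕ.⌊n/2⌋+⌈n/2⌉≡n n)
  (ℕ.+-monoˡ-≤ ⌈ n /2⌉ (ℕ.⌊n/2⌋≤⌈n/2⌉ n))

module _ {m : ℕ} {G : Graph m} (O : Orientation G) where

  no-arc : ∀ {u v} → adj G u v ≡ false → arc O u v ≡ false
  no-arc {u} {v} ¬uv with arc O u v in u→v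
  ... | false = refl
  ... | true with () ← trans (≡.sym ¬uv) (arc-edge O u v u→v)

  arc-reverse : ∀ {u v} → adj G u v ≡ true → arc O v u ≡ not (arc O u v)
  arc-reverse {u} {v} uv with arc O u v in u→v | arc O v u in v→u
  ... | true  | true  = contradiction v→u (antisym O u v u→v)
  ... | true  | false = refl
  ... | false | true  = refl
  ... | false | false with total O u v uv
  ...   | inj₁ u→v′ with () ← trans (≡.sym u→v) u→v′
  ...   | inj₂ v→u′ with () ← trans (≡.sym v→u) v→u′

  aut-adj : ∀ {φ u v} → IsAut O φ → adj G u v ≡ true → adj G (φ ⟨$⟩ʳ u) (φ ⟨$⟩ʳ v) ≡ true
  aut-adj {u = u} {v} aut uv with total O u v uv
  ... | inj₁ u→v = arc-edge O _ _ (aut u v u→v)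
  ... | inj₂ v→u = Graph.sym G _ _ (arc-edge O _ _ (aut v u v→u))

  aut-arc : ∀ {φ u v} → IsAut O φ → adj G u v ≡ true →
            arc O (φ ⟨$⟩ʳ u) (φ ⟨$⟩ʳ v) ≡ arc O u v
  aut-arc {φ} {u} {v} aut uv with arc O u v in u→v
  ... | true = aut u v u→v
  ... | false with arc O (φ ⟨$⟩ʳ u) (φ ⟨$⟩ʳ v) in φu→φv
  ...   | false = refl
  ...   | true  = contradiction (aut v u (trans (arc-reverse uv) (cong not u→v)))
                                (antisym O _ _ φu→φv)

orientation : ∀ {n} → (Fin n → Bool) → Orientation (K1 n)
orientation {n} d = record { arc = arcD ; arc-edge = arc-edge′ ; total = total′ ; antisym = antisym′ }
  where
  arcD : Fin (suc n) → Fin (suc n) → Bool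
  arcD zero    (suc k) = d k
  arcD (suc k) zero    = not (d k)
  arcD _       _       = false

  arc-edge′ : ∀ u v → arcD u v ≡ true → starAdj u v ≡ true
  arc-edge′ zero    (suc _) _ = refl
  arc-edge′ (suc _) zero    _ = refl

  total′ : ∀ u v → starAdj u v ≡ true → arcD u v ≡ true ⊎ arcD v u ≡ true
  total′ zero    (suc k) _ with d k
  ... | true  = inj₁ refl
  ... | false = inj₂ refl
  total′ (suc k) zero    _ with d k
  ... | true  = inj₂ refl
  ... | false = inj₁ refl

  antisym′ : ∀ u v → arcD u v ≡ true → arcD v u ≢ true
  antisym′ zero    (suc k) u→v v→u with d k
  antisym′ zero    (suc k) u→v ()  | true
  antisym′ zero    (suc k) ()  v→u | false
  antisym′ (suc k) zero    u→v v→u with d k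
  antisym′ (suc k) zero    ()  v→u | true
  antisym′ (suc k) zero    u→v ()  | false

leafArcLabelling : ∀ {n} {A : Set} → A → (Fin n → A) → Fin (suc n) → Fin (suc n) → A
leafArcLabelling c g zero    (suc k) = g k
leafArcLabelling c g (suc k) _       = g k
leafArcLabelling c g zero    zero    = c

module _ {n : ℕ} (O : Orientation (K1 n)) where

  dir : Fin n → Bool
  dir k = arc O zero (suc k)

  kind : Fin (suc n) → Maybe Bool
  kind zero    = nothing
  kind (suc k) = just (dir k)

  DirInjective : {A : Set} → (Fin n → A) → Set
  DirInjective g = Injective _≡_ _≡_ (λ k → dir k , g k)

  inward-arc : ∀ {k} → dir k ≡ false → arc O (suc k) zero ≡ true
  inward-arc dk = trans (arc-reverse O refl) (cong not dk)

  data StarArc : Fin (suc n) → Fin (suc n) → Set where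
    outward : ∀ {k} → dir k ≡ true  → StarArc zero (suc k)
    inward  : ∀ {k} → dir k ≡ false → StarArc (suc k) zero

  starArc : ∀ {u v} → arc O u v ≡ true → StarArc u v
  starArc {zero}  {suc k} u→v = outward u→v
  starArc {suc k} {zero}  u→v with dir k in dk
  ... | false = inward dk
  ... | true  = contradiction u→v (antisym O zero (suc k) dk)
  starArc {zero}  {zero}  u→v with () ← trans (≡.sym (no-arc O refl)) u→v
  starArc {suc _} {suc _} u→v with () ← trans (≡.sym (no-arc O refl)) u→v

  leaf : ∀ {u v} → StarArc u v → Fin n
  leaf (outward {k} _) = k
  leaf (inward  {k} _) = k

  leaf-injective : ∀ {u v u′ v′} (a : StarArc u v) (a′ : StarArc u′ v′) →
                   leaf a ≡ leaf a′ → u ≡ u′ × v ≡ v′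
  leaf-injective (outward _)  (outward _)  refl = refl , refl
  leaf-injective (inward _)   (inward _)   refl = refl , refl
  leaf-injective (outward dk) (inward dk′) refl with () ← trans (≡.sym dk) dk′
  leaf-injective (inward dk)  (outward dk′) refl with () ← trans (≡.sym dk) dk′

  arcBetween : Maybe Bool → Maybe Bool → Bool
  arcBetween nothing  (just b) = b
  arcBetween (just b) nothing  = not b
  arcBetween _        _        = false

  arc≡arcBetween : ∀ u v → arc O u v ≡ arcBetween (kind u) (kind v)
  arc≡arcBetween zero    zero    = no-arc O refl
  arc≡arcBetween zero    (suc _) = refl
  arc≡arcBetween (suc _) zero    = arc-reverse O refl
  arc≡arcBetween (suc _) (suc _) = no-arc O refl

  preserves-kind⇒aut : ∀ {φ} → Preserves kind φ → IsAut O φ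
  preserves-kind⇒aut {φ} pres u v u→v = begin
    arc O (φ ⟨$⟩ʳ u) (φ ⟨$⟩ʳ v)                      ≡⟨ arc≡arcBetween _ _ ⟩
    arcBetween (kind (φ ⟨$⟩ʳ u)) (kind (φ ⟨$⟩ʳ v))  ≡⟨ cong₂ arcBetween (pres u) (pres v) ⟩
    arcBetween (kind u) (kind v)                    ≡⟨ ≡.sym (arc≡arcBetween u v) ⟩
    arc O u v                                       ≡⟨ u→v ⟩
    true                                            ∎
    where open ≡-Reasoning

  -- If the centre went to a leaf, all n ≥ 2 leaves would have to go to the centre.
  aut-fixes-centre : ∀ {φ} → 2 ≤ n → IsAut O φ → φ ⟨$⟩ʳ zero ≡ zero
  aut-fixes-centre {φ} 2≤n aut with φ ⟨$⟩ʳ zero in φ0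
  ... | zero  = refl
  ... | suc k = contradiction (ℕ.≤-trans 2≤n (injective⇒≤ leaves-collapse)) λ { (s≤s ()) }
    where
    adjacent-leaf : ∀ {w} → starAdj (suc k) w ≡ true → w ≡ zero
    adjacent-leaf {zero} _ = refl

    leaf↦centre : ∀ x → φ ⟨$⟩ʳ suc x ≡ zero
    leaf↦centre x = adjacent-leaf
      (subst (λ w → starAdj w (φ ⟨$⟩ʳ suc x) ≡ true) φ0 (aut-adj O {φ} {zero} {suc x} aut refl))

    leaves-collapse : Injective _≡_ _≡_ (const {B = Fin n} (zero {0}))
    leaves-collapse {x} {y} _ =
      suc-injective (permutation-injective φ (trans (leaf↦centre x) (≡.sym (leaf↦centre y))))

  aut⇒preserves-kind : ∀ {φ} → 2 ≤ n → IsAut O φ → Preserves kind φ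
  aut⇒preserves-kind {φ} 2≤n aut zero = cong kind (aut-fixes-centre {φ} 2≤n aut)
  aut⇒preserves-kind {φ} 2≤n aut (suc k) with φ ⟨$⟩ʳ suc k in φk
  ... | zero  with () ← permutation-injective φ (trans φk (≡.sym (aut-fixes-centre {φ} 2≤n aut)))
  ... | suc l = cong just (trans (cong₂ (arc O) (≡.sym (aut-fixes-centre {φ} 2≤n aut)) (≡.sym φk))
                                 (aut-arc O {φ} {zero} {suc k} aut refl))

  preserves-kind⇒fixes-centre : ∀ {φ} → Preserves kind φ → φ ⟨$⟩ʳ zero ≡ zero
  preserves-kind⇒fixes-centre {φ} pres with φ ⟨$⟩ʳ zero | pres zero
  ... | zero  | _  = refl
  ... | suc _ | ()

  preserves-kind⇒leaf : ∀ {φ} → Preserves kind φ →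
                        ∀ k → ∃[ l ] φ ⟨$⟩ʳ suc k ≡ suc l × dir l ≡ dir k
  preserves-kind⇒leaf {φ} pres k with φ ⟨$⟩ʳ suc k | pres (suc k)
  ... | zero  | ()
  ... | suc l | dl = l , refl , just-injective dl

  injective⇔dirInjective : ∀ {A} {f : Fin (suc n) → A} →
    Injective _≡_ _≡_ (λ u → kind u , f u) ⇔ DirInjective (f ∘ suc)
  injective⇔dirInjective {f = f} = mk⇔ (λ inj {i} {j} e → suc-injective (inj (cong (map₁ just) e))) fromLeaves
    where
    fromLeaves : DirInjective (f ∘ suc) → Injective _≡_ _≡_ (λ u → kind u , f u)
    fromLeaves inj {zero}  {zero}  _ = refl
    fromLeaves inj {suc i} {suc j} e =
      cong suc (inj (cong₂ _,_ (just-injective (cong proj₁ e)) (cong proj₂ e)))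
    fromLeaves inj {zero}  {suc _} ()
    fromLeaves inj {suc _} {zero}  ()

  distinguishingV⇔dirInjective : ∀ {r} {λv : Fin (suc n) → Fin r} → 2 ≤ n →
    DistinguishingV O r λv ⇔ DirInjective (λv ∘ suc)
  distinguishingV⇔dirInjective {r} {λv} 2≤n =
    ⇔.trans distinguishing⇔rigid (⇔.trans rigid⇔injective injective⇔dirInjective)
    where
    distinguishing⇔rigid : DistinguishingV O r λv ⇔ Rigid (λ u → kind u , λv u)
    distinguishing⇔rigid = mk⇔
      (λ dist φ pres → dist φ (preserves-kind⇒aut {φ} (cong proj₁ ∘ pres)) (cong proj₂ ∘ pres))
      (λ rigid φ aut pres → rigid φ (λ u → cong₂ _,_ (aut⇒preserves-kind {φ} 2≤n aut u) (pres u)))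

  arcLabel : {A : Set} → (Fin (suc n) → Fin (suc n) → A) → Fin n → A
  arcLabel λa k = if dir k then λa zero (suc k) else λa (suc k) zero

  arcLabel-starArc : ∀ {A} (λa : Fin (suc n) → Fin (suc n) → A) {u v} (a : StarArc u v) →
                     arcLabel λa (leaf a) ≡ λa u v
  arcLabel-starArc λa (outward dk) rewrite dk = refl
  arcLabel-starArc λa (inward  dk) rewrite dk = refl

  arcLabel-cong : ∀ {A} {μ ν : Fin (suc n) → Fin (suc n) → A} →
                  (∀ u v → arc O u v ≡ true → μ u v ≡ ν u v) → ∀ k → arcLabel μ k ≡ arcLabel ν k
  arcLabel-cong μ≡ν k with dir k in dk
  ... | true  = μ≡ν zero (suc k) dk
  ... | false = μ≡ν (suc k) zero (inward-arc dk)

  arcLabel-permute : ∀ {A} (λa : Fin (suc n) → Fin (suc n) → A) {φ} → Preserves kind φ → ∀ c k →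
    arcLabel (λ u v → λa (φ ⟨$⟩ʳ u) (φ ⟨$⟩ʳ v)) k ≡ (c ∷ arcLabel λa) (φ ⟨$⟩ʳ suc k)
  arcLabel-permute λa {φ} pres c k with preserves-kind⇒leaf {φ} pres k
  ... | l , φk , dl rewrite φk | preserves-kind⇒fixes-centre {φ} pres | dl = refl

  -- λa zero zero merely fills the centre; (zero, zero) is never an arc.
  arcLabels-preserved⇔ : ∀ {A : Set} (λa : Fin (suc n) → Fin (suc n) → A) {φ} → Preserves kind φ →
    (∀ u v → arc O u v ≡ true → λa (φ ⟨$⟩ʳ u) (φ ⟨$⟩ʳ v) ≡ λa u v) ⇔
    Preserves (λa zero zero ∷ arcLabel λa) φ
  arcLabels-preserved⇔ {A} λa {φ} pres = mk⇔ onLeaves onArcs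
    where
    c : A
    c = λa zero zero

    onLeaves : (∀ u v → arc O u v ≡ true → λa (φ ⟨$⟩ʳ u) (φ ⟨$⟩ʳ v) ≡ λa u v) →
               Preserves (c ∷ arcLabel λa) φ
    onLeaves arcs zero    = cong (c ∷ arcLabel λa) (preserves-kind⇒fixes-centre {φ} pres)
    onLeaves arcs (suc k) = trans (≡.sym (arcLabel-permute λa {φ} pres c k)) (arcLabel-cong arcs k)

    onArcs : Preserves (c ∷ arcLabel λa) φ →
             ∀ u v → arc O u v ≡ true → λa (φ ⟨$⟩ʳ u) (φ ⟨$⟩ʳ v) ≡ λa u v
    onArcs labels u v u→v = begin
      λa (φ ⟨$⟩ʳ u) (φ ⟨$⟩ʳ v)                           ≡⟨ arcLabel-starArc (λ u v → λa (φ ⟨$⟩ʳ u) (φ ⟨$⟩ʳ v)) a ⟨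
      arcLabel (λ u v → λa (φ ⟨$⟩ʳ u) (φ ⟨$⟩ʳ v)) (leaf a) ≡⟨ arcLabel-permute λa {φ} pres c (leaf a) ⟩
      (c ∷ arcLabel λa) (φ ⟨$⟩ʳ suc (leaf a))           ≡⟨ labels (suc (leaf a)) ⟩
      arcLabel λa (leaf a)                              ≡⟨ arcLabel-starArc λa a ⟩
      λa u v                                            ∎
      where
      open ≡-Reasoning
      a : StarArc u v
      a = starArc u→v

  distinguishingA⇔dirInjective : ∀ {r} {λa : Fin (suc n) → Fin (suc n) → Fin r} → 2 ≤ n →
    DistinguishingA O r λa ⇔ DirInjective (arcLabel λa)
  distinguishingA⇔dirInjective {r} {λa} 2≤n =
    ⇔.trans distinguishing⇔rigid (⇔.trans rigid⇔injective injective⇔dirInjective)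
    where
    distinguishing⇔rigid : DistinguishingA O r λa ⇔ Rigid (λ u → kind u , (λa zero zero ∷ arcLabel λa) u)
    distinguishing⇔rigid = mk⇔
      (λ dist φ pres → let kinds = cong proj₁ ∘ pres in
        dist φ (preserves-kind⇒aut {φ} kinds) (from (arcLabels-preserved⇔ λa {φ} kinds) (cong proj₂ ∘ pres)))
      (λ rigid φ aut arcs → let kinds = aut⇒preserves-kind {φ} 2≤n aut in
        rigid φ (λ u → cong₂ _,_ (kinds u) (to (arcLabels-preserved⇔ λa {φ} kinds) arcs u)))

  properV⇒centre-distinct : ∀ {r λv} → ProperV O r λv → ∀ k → λv zero ≢ λv (suc k)
  properV⇒centre-distinct proper k with dir k in dk
  ... | true  = proper zero (suc k) dk
  ... | false = proper (suc k) zero (inward-arc dk) ∘ ≡.sym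

  centre-distinct⇒properV : ∀ {r λv} → (∀ k → λv zero ≢ λv (suc k)) → ProperV O r λv
  centre-distinct⇒properV distinct u v u→v with starArc u→v
  ... | outward {k} _ = distinct k
  ... | inward  {k} _ = distinct k ∘ ≡.sym

  properA⇒injective : ∀ {r λa} → ProperA O r λa → Injective _≡_ _≡_ (arcLabel λa)
  properA⇒injective proper {i} {j} e with i ≟ j
  ... | yes i≡j = i≡j
  ... | no i≢j with dir i in di | dir j in dj
  ...   | true  | true  = contradiction e (proper zero (suc i) zero (suc j) di dj
                            (i≢j ∘ suc-injective ∘ proj₂) (inj₁ refl))
  ...   | true  | false = contradiction e (proper zero (suc i) (suc j) zero di (inward-arc dj)
                            (λ { (() , _) }) (inj₂ (inj₁ refl)))
  ...   | false | true  = contradiction e (proper (suc i) zero zero (suc j) (inward-arc di) dj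
                            (λ { (() , _) }) (inj₂ (inj₂ (inj₁ refl))))
  ...   | false | false = contradiction e (proper (suc i) zero (suc j) zero (inward-arc di) (inward-arc dj)
                            (i≢j ∘ suc-injective ∘ proj₁) (inj₂ (inj₂ (inj₂ refl))))

  leafArcLabelling-starArc : ∀ {A} {c : A} {g u v} (a : StarArc u v) → leafArcLabelling c g u v ≡ g (leaf a)
  leafArcLabelling-starArc (outward _) = refl
  leafArcLabelling-starArc (inward  _) = refl

  leafArcLabelling-proper : ∀ {r} (c : Fin r) {g} → Injective _≡_ _≡_ g → ProperA O r (leafArcLabelling c g)
  leafArcLabelling-proper c inj u v u′ v′ u→v u′→v′ different _ e = different
    (leaf-injective a a′ (inj (trans (≡.sym (leafArcLabelling-starArc a)) (trans e (leafArcLabelling-starArc a′)))))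
    where
    a : StarArc u v
    a = starArc u→v
    a′ : StarArc u′ v′
    a′ = starArc u′→v′

  LeafLabels : ℕ → Set
  LeafLabels r = Σ (Fin n → Fin r) DirInjective

  module _ (2≤n : 2 ≤ n) {r : ℕ} where

    leafLabels-of-distV : HasDistVLabelling O r → LeafLabels r
    leafLabels-of-distV (λv , dist) = λv ∘ suc , to (distinguishingV⇔dirInjective 2≤n) dist

    leafLabels-of-distA : HasDistALabelling O r → LeafLabels r
    leafLabels-of-distA (λa , dist) = arcLabel λa , to (distinguishingA⇔dirInjective 2≤n) dist

    leafLabels-of-colouringV : HasDistVColouring O (suc r) → LeafLabels r
    leafLabels-of-colouringV (λv , proper , dist) = (λ k → punchOut (distinct k)) , λ e →
      inj (cong₂ _,_ (cong proj₁ e) (punchOut-injective (distinct _) (distinct _) (cong proj₂ e)))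
      where
      distinct : ∀ k → λv zero ≢ λv (suc k)
      distinct = properV⇒centre-distinct proper
      inj : DirInjective (λv ∘ suc)
      inj = to (distinguishingV⇔dirInjective 2≤n) dist

    distV-of-leafLabels : Fin r → LeafLabels r → HasDistVLabelling O r
    distV-of-leafLabels c (g , inj) = c ∷ g , from (distinguishingV⇔dirInjective 2≤n) inj

    distA-of-leafLabels : Fin r → LeafLabels r → HasDistALabelling O r
    distA-of-leafLabels c (g , inj) = leafArcLabelling c g , from (distinguishingA⇔dirInjective 2≤n)
      λ e → inj (cong₂ _,_ (cong proj₁ e) (trans (≡.sym (if-eta (dir _))) (trans (cong proj₂ e) (if-eta (dir _)))))

    colouringV-of-leafLabels : LeafLabels r → HasDistVColouring O (suc r)
    colouringV-of-leafLabels (g , inj) = zero ∷ (suc ∘ g) , centre-distinct⇒properV (λ _ ()) ,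
      from (distinguishingV⇔dirInjective 2≤n) λ e → inj (cong₂ _,_ (cong proj₁ e) (suc-injective (cong proj₂ e)))

    colouringA-of-injective : Fin r → (g : Fin n → Fin r) → Injective _≡_ _≡_ g → HasDistAColouring O r
    colouringA-of-injective c g inj =
      leafArcLabelling c g , leafArcLabelling-proper c inj , proj₂ (distA-of-leafLabels c (g , inj ∘ cong proj₂))

  colouringV-bound : ∀ (2≤n : 2 ≤ n) {k} → (∀ {r} → LeafLabels r → k ≤ r) →
                     ∀ {r} → HasDistVColouring O r → suc k ≤ r
  colouringV-bound 2≤n bound {zero}  (λv , _) with () ← λv zero
  colouringV-bound 2≤n bound {suc _} col = s≤s (bound (leafLabels-of-colouringV 2≤n col))

  colouringA-bound : ∀ {r} → HasDistAColouring O r → n ≤ r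
  colouringA-bound (λa , proper , _) = injective⇒≤ (properA⇒injective proper)

module _ {m : ℕ} {G : Graph m} (Has : Orientation G → ℕ → Set) {k : ℕ} where

  minOver-least : (O : Orientation G) → Has O k → (∀ O {r} → Has O r → k ≤ r) →
                  MinOver G (λ O → IsLeast (Has O)) k
  minOver-least O has lower = (O , has , λ _ → lower O) , λ O′ k′ least → lower O′ (proj₁ least)

  maxOver-least : (O : Orientation G) → Has O k → (∀ {r} → Has O r → k ≤ r) → (∀ O → Has O k) →
                  MaxOver G (λ O → IsLeast (Has O)) k
  maxOver-least O has lower always = (O , has , λ _ → lower) , λ O′ k′ least → proj₂ least k (always O′)

theorem9 : ∀ (n : ℕ) → 3 ≤ n →
    MinOver (K1 n) D≡ ⌈ n /2⌉ × MinOver (K1 n) D'≡ ⌈ n /2⌉ ×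
    MaxOver (K1 n) D≡ n × MaxOver (K1 n) D'≡ n ×
    MinOver (K1 n) χD≡ (1 + ⌈ n /2⌉) × MaxOver (K1 n) χD≡ (n + 1) ×
    MinOver (K1 n) χ'D≡ n × MaxOver (K1 n) χ'D≡ n
theorem9 n@(suc (suc (suc _))) (s≤s (s≤s (s≤s _))) =
    minOver-least HasDistVLabelling balanced (distV-of-leafLabels balanced 2≤n zero balancedLabels)
      (λ O → halfBound O ∘ leafLabels-of-distV O 2≤n)
  , minOver-least HasDistALabelling balanced (distA-of-leafLabels balanced 2≤n zero balancedLabels)
      (λ O → halfBound O ∘ leafLabels-of-distA O 2≤n)
  , maxOver-least HasDistVLabelling allOutward (identityLabelling allOutward)
      (allOutwardBound ∘ leafLabels-of-distV allOutward 2≤n) identityLabelling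
  , maxOver-least HasDistALabelling allOutward (identityArcLabelling allOutward)
      (allOutwardBound ∘ leafLabels-of-distA allOutward 2≤n) identityArcLabelling
  , minOver-least HasDistVColouring balanced (colouringV-of-leafLabels balanced 2≤n balancedLabels)
      (λ O → colouringV-bound O 2≤n (halfBound O))
  , maxOver-least HasDistVColouring allOutward (identityColouring allOutward)
      (λ {r} → subst (_≤ r) 1+n≡n+1 ∘ colouringV-bound allOutward 2≤n allOutwardBound) identityColouring
  , minOver-least HasDistAColouring allOutward (identityArcColouring allOutward) colouringA-bound
  , maxOver-least HasDistAColouring allOutward (identityArcColouring allOutward)
      (colouringA-bound allOutward) identityArcColouring
  where
  2≤n : 2 ≤ n
  2≤n = s≤s (s≤s z≤n)

  1+n≡n+1 : suc n ≡ n + 1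
  1+n≡n+1 = ℕ.+-comm 1 n

  halfInjection : Σ (Fin n → Bool × Fin ⌈ n /2⌉) (Injective _≡_ _≡_)
  halfInjection = ≤-double⇒injection (n≤⌈n/2⌉+⌈n/2⌉ n)

  balanced allOutward : Orientation (K1 n)
  balanced   = orientation (proj₁ ∘ proj₁ halfInjection)
  allOutward = orientation (const true)

  balancedLabels : LeafLabels balanced ⌈ n /2⌉
  balancedLabels = proj₂ ∘ proj₁ halfInjection , proj₂ halfInjection

  identityLabels : ∀ O → LeafLabels O n
  identityLabels O = id , cong proj₂

  identityLabelling : ∀ O → HasDistVLabelling O n
  identityLabelling O = distV-of-leafLabels O 2≤n zero (identityLabels O)

  identityArcLabelling : ∀ O → HasDistALabelling O n
  identityArcLabelling O = distA-of-leafLabels O 2≤n zero (identityLabels O)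

  identityColouring : ∀ O → HasDistVColouring O (n + 1)
  identityColouring O = subst (HasDistVColouring O) 1+n≡n+1 (colouringV-of-leafLabels O 2≤n (identityLabels O))

  identityArcColouring : ∀ O → HasDistAColouring O n
  identityArcColouring O = colouringA-of-injective O 2≤n zero id id

  halfBound : ∀ O {r} → LeafLabels O r → ⌈ n /2⌉ ≤ r
  halfBound O = injective⇒⌈/2⌉≤ ∘ proj₂

  allOutwardBound : ∀ {r} → LeafLabels allOutward r → n ≤ r
  allOutwardBound (g , inj) = injective⇒≤ (inj ∘ cong (true ,_))
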